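{- Let $\langle M,\sqsubseteq\rangle$ be a model of set-theoretic mereology. Then $\langle M,\sqsubseteq\rangle$ is $\omega$-saturated if and only if both (1) every infinite element of $M$ is the join of two disjoint infinite elements, and (2) for every element $a\in M$ there is an infinite element $u\in M$ disjoint from $a$. Equivalently, $\langle M,\sqsubseteq\rangle$ is $\omega$-saturated if and only if there are infinite elements and for every infinite element $u$ there is an element $x$ for which $u-x$, $u\cap x$ and $x-u$ are each infinite.
   Context: A model of set-theoretic mereology is a structure $\langle M,\sqsubseteq\rangle$ in which $\sqsubseteq$ is an unbounded (no largest element) atomic relatively complemented distributive lattice order; $\cup,\cap,-$ denote join, meet, and relative complement, and two elements are disjoint if their meet is the least element. An element $u\in M$ is called infinite if it is not the join of finitely many atoms (equivalently, infinitely many atoms lie below it). $\omega$-saturated means every 1-type over finitely many parameters from $M$ that is finitely satisfiable in $M$ is realized in $M$. -}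

module Defs where

open import Level using (Level; 0ℓ) renaming (suc to lsuc)
open import Data.Nat using (ℕ; zero; suc)
open import Data.Fin using (Fin; zero; suc)
open import Data.List using (List; []; _∷_; foldr)
open import Data.List.Relation.Unary.All using (All)
open import Data.Product using (Σ; ∃; _×_; _,_)
open import Data.Sum using (_⊎_)
open import Data.Empty using (⊥)
open import Relation.Nullary using (¬_)
open import Relation.Binary.PropositionalEquality using (_≡_)

-- Joins, meets and the least element are determined by ⊑; they are
-- carried as fields together with their defining (lub/glb/least)
-- properties.

record IsMereology {M : Set} (_⊑_ : M → M → Set) : Set where
  field
    ⊑-refl    : ∀ x → x ⊑ x
    ⊑-trans   : ∀ {x y z} → x ⊑ y → y ⊑ z → x ⊑ z
    ⊑-antisym : ∀ {x y} → x ⊑ y → y ⊑ x → x ≡ y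
    _∪_       : M → M → M
    ∪-upperˡ  : ∀ x y → x ⊑ (x ∪ y)
    ∪-upperʳ  : ∀ x y → y ⊑ (x ∪ y)
    ∪-least   : ∀ {x y z} → x ⊑ z → y ⊑ z → (x ∪ y) ⊑ z
    _∩_       : M → M → M
    ∩-lowerˡ  : ∀ x y → (x ∩ y) ⊑ x
    ∩-lowerʳ  : ∀ x y → (x ∩ y) ⊑ y
    ∩-greatest : ∀ {x y z} → z ⊑ x → z ⊑ y → z ⊑ (x ∩ y)
    𝟘         : M
    𝟘-least   : ∀ x → 𝟘 ⊑ x
    distrib   : ∀ x y z → (x ∩ (y ∪ z)) ≡ ((x ∩ y) ∪ (x ∩ z))
    relCompl  : ∀ {a b c} → a ⊑ b → b ⊑ c →
                Σ M (λ d → ((b ∩ d) ≡ a) × ((b ∪ d) ≡ c))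
    atomic    : ∀ x → ¬ (x ≡ 𝟘) →
                Σ M (λ a → (¬ (a ≡ 𝟘) × (∀ y → y ⊑ a → (y ≡ 𝟘) ⊎ (y ≡ a))) × a ⊑ x)
    unbounded : ∀ x → Σ M (λ y → ¬ (y ⊑ x))

module Mereology {M : Set} (_⊑_ : M → M → Set) (isM : IsMereology _⊑_) where
  open IsMereology isM public

  IsAtom : M → Set
  IsAtom a = ¬ (a ≡ 𝟘) × (∀ y → y ⊑ a → (y ≡ 𝟘) ⊎ (y ≡ a))

  ⋃ : List M → M
  ⋃ = foldr _∪_ 𝟘

  Infinite : M → Set
  Infinite u = ¬ (Σ (List M) (λ as → All IsAtom as × (u ≡ ⋃ as)))

  Disjoint : M → M → Set
  Disjoint x y = (x ∩ y) ≡ 𝟘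

  -- d is the relative complement u - x
  -- (the complement of u ∩ x in the interval [𝟘 , u])
  IsDiff : M → M → M → Set
  IsDiff u x d = ((d ∩ (u ∩ x)) ≡ 𝟘) × ((d ∪ (u ∩ x)) ≡ u)

data Formula (n : ℕ) : Set where
  _⊑'_ : Fin n → Fin n → Formula n
  _≐_  : Fin n → Fin n → Formula n
  ⊥'   : Formula n
  _⇒_  : Formula n → Formula n → Formula n
  _∧'_ : Formula n → Formula n → Formula n
  _∨'_ : Formula n → Formula n → Formula n
  ∀'   : Formula (suc n) → Formula n
  ∃'   : Formula (suc n) → Formula n

_∷ₑ_ : {M : Set} {n : ℕ} → M → (Fin n → M) → Fin (suc n) → M
(m ∷ₑ ρ) zero    = m
(m ∷ₑ ρ) (suc i) = ρ i

Sat : {M : Set} (_⊑_ : M → M → Set) {n : ℕ} → (Fin n → M) → Formula n → Set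
Sat _⊑_ ρ (i ⊑' j) = ρ i ⊑ ρ j
Sat _⊑_ ρ (i ≐ j)  = ρ i ≡ ρ j
Sat _⊑_ ρ ⊥'       = ⊥
Sat _⊑_ ρ (φ ⇒ ψ)  = Sat _⊑_ ρ φ → Sat _⊑_ ρ ψ
Sat _⊑_ ρ (φ ∧' ψ) = Sat _⊑_ ρ φ × Sat _⊑_ ρ ψ
Sat _⊑_ ρ (φ ∨' ψ) = Sat _⊑_ ρ φ ⊎ Sat _⊑_ ρ ψ
Sat _⊑_ ρ (∀' φ)   = ∀ m → Sat _⊑_ (m ∷ₑ ρ) φ
Sat _⊑_ ρ (∃' φ)   = Σ _ (λ m → Sat _⊑_ (m ∷ₑ ρ) φ)

-- A 1-type over k parameters is a set p of formulas with k+1 free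
-- variables: variable zero is the type variable x, variable (suc i) is
-- interpreted by the parameter a i.
OneType : ℕ → Set₁
OneType k = Formula (suc k) → Set

module _ {M : Set} (_⊑_ : M → M → Set) where

  Realizes : {k : ℕ} → (Fin k → M) → M → List (Formula (suc k)) → Set
  Realizes a m φs = All (Sat _⊑_ (m ∷ₑ a)) φs

  FinitelySatisfiable : {k : ℕ} → (Fin k → M) → OneType k → Set
  FinitelySatisfiable {k} a p =
    ∀ (φs : List (Formula (suc k))) → All p φs → Σ M (λ m → Realizes a m φs)

  Realized : {k : ℕ} → (Fin k → M) → OneType k → Set
  Realized a p = Σ M (λ m → ∀ φ → p φ → Sat _⊑_ (m ∷ₑ a) φ)

  OmegaSaturated : Set₁
  OmegaSaturated = ∀ (k : ℕ) (a : Fin k → M) (p : OneType k) →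
                   FinitelySatisfiable a p → Realized a p

-- Over a tuple ρ of parameters the atoms fall into cells, one for each pattern of which ρ i
-- they lie below.  By a back-and-forth argument, two tuples whose corresponding cells have the
-- same number of atoms up to 2^d satisfy the same formulas of quantifier depth d: a new element
-- is matched cell by cell, copying its part in a cell when that part (or its complement in the
-- cell) is small, and otherwise taking a large part.  To realise a finitely satisfiable type one
-- chooses x₀, x₁, … such that the type stays finitely satisfiable among the elements matching
-- x_N up to N (these fall into finitely many classes), and then assembles cell by cell a limit
-- matching every x_N up to N.  The two conditions are exactly what this assembly needs where
-- both the inside and the outside of a cell grow without bound: cutting an infinite cell into
-- two infinite halves, or finding an infinite element outside all parameters.  Conversely each
-- condition is the realisation of a type asking for at least m atoms, for every m.

module Submission where

open import Defs
open import Level using (0ℓ)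
open import Axiom.ExcludedMiddle using (ExcludedMiddle)
open import Axiom.DoubleNegationElimination using (em⇒dne)
open import Data.Bool using (Bool; true; false)
import Data.Bool as Bool
open import Data.Empty using (⊥)
open import Data.Fin using (Fin; zero; suc)
open import Data.Fin.Properties using (any?)
open import Data.List using (List; []; _∷_; _++_; length; take; tabulate; upTo)
open import Data.List.Properties using (length-++; length-take; length-removeAt′)
open import Data.List.Membership.Propositional using (_∈_; _∉_)
open import Data.List.Membership.Propositional.Properties using (∈-upTo⁺)
open import Data.List.Relation.Unary.All using (All; []; _∷_)
import Data.List.Relation.Unary.All as All
open import Data.List.Relation.Unary.All.Properties using (¬Any⇒All¬; All¬⇒¬Any; ++⁺; ++⁻ˡ; ++⁻ʳ; take⁺)
open import Data.List.Relation.Unary.AllPairs using ([]; _∷_)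
open import Data.List.Relation.Unary.Any using (Any; here; there; _─_)
import Data.List.Relation.Unary.Any as Any
open import Data.List.Relation.Unary.Unique.Propositional using (Unique)
import Data.List.Relation.Unary.Unique.Propositional.Properties as Unique
open import Data.Nat using (ℕ; zero; suc; _+_; _^_; _⊔_; _≤_; _<_; _≤′_; ≤′-refl; ≤′-step; z≤n; s≤s; _≤?_)
open import Data.Nat.Properties
open import Data.Product using (Σ; _×_; _,_; proj₁; proj₂)
open import Data.Sum using (_⊎_; inj₁; inj₂; [_,_]′)
open import Data.Vec using (Vec; []; _∷_; lookup)
open import Function.Base using (_∘_)
open import Function.Bundles using (_⇔_; mk⇔; module Equivalence)
open Equivalence using (to; from)
import Function.Properties.Equivalence as ⇔
open import Relation.Nullary using (¬_; yes; no; contradiction)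
open import Relation.Unary using (Pred; _⊆_)
open import Relation.Binary.PropositionalEquality using (_≡_; _≢_; refl; sym; trans; cong; cong₂; subst)

module Counting (lem : ExcludedMiddle 0ℓ) {A : Set} where

  private
    dne = em⇒dne lem
    variable
      P Q R : Pred A 0ℓ
      x : A
      xs ys : List A
      m n N : ℕ

  AtLeast : Pred A 0ℓ → ℕ → Set
  AtLeast P m = Σ (List A) λ xs → Unique xs × All P xs × m ≤ length xs

  _∖_ : Pred A 0ℓ → List A → Pred A 0ℓ
  (P ∖ xs) x = P x × x ∉ xs

  atLeast-zero : AtLeast P 0
  atLeast-zero = [] , [] , [] , z≤n

  atLeast-≤ : m ≤ n → AtLeast P n → AtLeast P m
  atLeast-≤ m≤n (xs , u , ps , n≤) = xs , u , ps , ≤-trans m≤n n≤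

  atLeast-⊆ : P ⊆ Q → AtLeast P m → AtLeast Q m
  atLeast-⊆ P⊆Q (xs , u , ps , m≤) = xs , u , All.map P⊆Q ps , m≤

  atLeast-∷ : P x → x ∉ xs → Unique xs → All P xs → AtLeast P (suc (length xs))
  atLeast-∷ {xs = xs} px x∉xs u ps = _ , ¬Any⇒All¬ xs x∉xs ∷ u , px ∷ ps , ≤-refl

  atLeast-1 : AtLeast P 1 ⇔ Σ A P
  atLeast-1 = mk⇔ (λ { (x ∷ _ , _ , px ∷ _ , _) → x , px }) (λ (x , px) → x ∷ [] , [] ∷ [] , px ∷ [] , ≤-refl)

  exactly : AtLeast P m → Σ (List A) λ xs → Unique xs × All P xs × length xs ≡ m
  exactly {m = m} (xs , u , ps , m≤) =
    take m xs , Unique.take⁺ m u , take⁺ m ps , trans (length-take m xs) (m≤n⇒m⊓n≡m m≤)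

  ∈-─⁺ : ∀ {y} (p : x ∈ ys) → y ∈ ys → y ≢ x → y ∈ (ys ─ p)
  ∈-─⁺ (here refl) (here refl) y≢x = contradiction refl y≢x
  ∈-─⁺ (here refl) (there q)   _   = q
  ∈-─⁺ (there p)   (here refl) _   = here refl
  ∈-─⁺ (there p)   (there q)   y≢x = there (∈-─⁺ p q y≢x)

  part-outside : Unique xs → ∀ ys →
          Σ (List A) λ zs → Unique zs × All (_∉ ys) zs × All (_∈ xs) zs × length xs ≤ length zs + length ys
  part-outside [] ys = [] , [] , [] , [] , z≤n
  part-outside {x ∷ xs} (x∉xs ∷ u) ys with lem {x ∈ ys}
  ... | yes x∈ys =
    let zs , uz , zs∉ , zs⊆ , len = part-outside u (ys ─ x∈ys)
        z∉ys : ∀ {z} → z ∉ (ys ─ x∈ys) → z ∈ xs → z ∉ ys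
        z∉ys z∉ z∈xs z∈ys = z∉ (∈-─⁺ x∈ys z∈ys λ { refl → All¬⇒¬Any x∉xs z∈xs })
    in zs , uz , All.zipWith (λ (z∉ , z∈xs) → z∉ys z∉ z∈xs) (zs∉ , zs⊆) , All.map there zs⊆ ,
       (begin
         suc (length xs)                          ≤⟨ s≤s len ⟩
         suc (length zs + length (ys ─ x∈ys))     ≡⟨ sym (+-suc _ _) ⟩
         length zs + suc (length (ys ─ x∈ys))     ≡⟨ cong (length zs +_) (sym (length-removeAt′ ys _)) ⟩
         length zs + length ys                    ∎)
    where open ≤-Reasoning
  ... | no x∉ys =
    let zs , uz , zs∉ , zs⊆ , len = part-outside u ys
    in x ∷ zs , ¬Any⇒All¬ zs (All¬⇒¬Any x∉xs ∘ All.lookup zs⊆) ∷ uz , x∉ys ∷ zs∉ ,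
       here refl ∷ All.map there zs⊆ , s≤s len

  length-≤ : Unique xs → All (_∈ ys) xs → length xs ≤ length ys
  length-≤ {ys = ys} u xs⊆ys with part-outside u ys
  ... | [] , _ , _ , _ , len = len
  ... | z ∷ _ , _ , z∉ys ∷ _ , z∈xs ∷ _ , _ = contradiction (All.lookup xs⊆ys z∈xs) z∉ys

  atLeast-∈⁻ : AtLeast (_∈ ys) m → m ≤ length ys
  atLeast-∈⁻ (xs , u , xs⊆ys , m≤) = ≤-trans m≤ (length-≤ u xs⊆ys)

  atLeast-∈⁺ : Unique xs → AtLeast (_∈ xs) (length xs)
  atLeast-∈⁺ ux = _ , ux , All.tabulate (λ x∈ → x∈) , ≤-refl

  atLeast-∖⁻ : AtLeast P (m + length ys) → AtLeast (P ∖ ys) m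
  atLeast-∖⁻ {m = m} {ys = ys} (xs , u , ps , m+≤) =
    let zs , uz , zs∉ , zs⊆ , len = part-outside u ys
    in zs , uz , All.zipWith (λ (z∉ , z∈) → All.lookup ps z∈ , z∉) (zs∉ , zs⊆) ,
       +-cancelʳ-≤ (length ys) m (length zs) (≤-trans m+≤ len)

  atLeast-∖⁺ : Unique ys → All P ys → AtLeast (P ∖ ys) m → AtLeast P (m + length ys)
  atLeast-∖⁺ {ys = ys} {m = m} uy pys (xs , u , ps , m≤) =
    xs ++ ys , Unique.++⁺ u uy (λ (x∈xs , x∈ys) → proj₂ (All.lookup ps x∈xs) x∈ys) ,
    ++⁺ (All.map proj₁ ps) pys ,
    subst (m + length ys ≤_) (sym (length-++ xs)) (+-monoˡ-≤ (length ys) m≤)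

  atLeast-+ : (∀ {x} → P x → Q x → ⊥) → AtLeast P m → AtLeast Q n → AtLeast (λ x → P x ⊎ Q x) (m + n)
  atLeast-+ P∩Q≡∅ P≥m Q≥n with exactly Q≥n
  ... | ys , uy , qys , refl =
    atLeast-∖⁺ uy (All.map inj₂ qys) (atLeast-⊆ (λ px → inj₁ px , P∩Q≡∅ px ∘ All.lookup qys) P≥m)

  complete : ∀ n → ¬ AtLeast P n → Σ (List A) λ xs → Unique xs × All P xs × length xs < n × P ⊆ (_∈ xs)
  complete zero ¬P0 = contradiction atLeast-zero ¬P0
  complete (suc n) ¬Pn+1 with lem {AtLeast _ n}
  ... | no ¬Pn = let xs , u , ps , len , P⊆ = complete n ¬Pn in xs , u , ps , m≤n⇒m≤1+n len , P⊆
  ... | yes Pn =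
    let xs , u , ps , len≡n = exactly Pn
    in xs , u , ps , s≤s (≤-reflexive len≡n) ,
       λ px → dne λ x∉xs → ¬Pn+1 (subst (AtLeast _ ∘ suc) len≡n (atLeast-∷ px x∉xs u ps))

  infix 4 _≃[_]_
  _≃[_]_ : Pred A 0ℓ → ℕ → Pred A 0ℓ → Set
  P ≃[ N ] Q = ∀ m → m ≤ N → AtLeast P m ⇔ AtLeast Q m

  ≃-refl : P ≃[ N ] P
  ≃-refl _ _ = ⇔.refl

  ≃-sym : P ≃[ N ] Q → Q ≃[ N ] P
  ≃-sym P≃Q m m≤N = ⇔.sym (P≃Q m m≤N)

  ≃-trans : P ≃[ N ] Q → Q ≃[ N ] R → P ≃[ N ] R
  ≃-trans P≃Q Q≃R m m≤N = ⇔.trans (P≃Q m m≤N) (Q≃R m m≤N)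

  ≃-≤ : m ≤ N → P ≃[ N ] Q → P ≃[ m ] Q
  ≃-≤ m≤N P≃Q k k≤m = P≃Q k (≤-trans k≤m m≤N)

  ⊆⊇⇒≃ : P ⊆ Q → Q ⊆ P → P ≃[ N ] Q
  ⊆⊇⇒≃ P⊆Q Q⊆P _ _ = mk⇔ (atLeast-⊆ P⊆Q) (atLeast-⊆ Q⊆P)

  ⇔⇒≃ : (∀ {x} → P x ⇔ Q x) → P ≃[ N ] Q
  ⇔⇒≃ P⇔Q = ⊆⊇⇒≃ (to P⇔Q) (from P⇔Q)

  atLeast⇒≃ : AtLeast P N → AtLeast Q N → P ≃[ N ] Q
  atLeast⇒≃ P≥N Q≥N m m≤N = mk⇔ (λ _ → atLeast-≤ m≤N Q≥N) (λ _ → atLeast-≤ m≤N P≥N)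

  ≃-zero : P ≃[ 0 ] Q
  ≃-zero = atLeast⇒≃ atLeast-zero atLeast-zero

  ≃-beyond : P ≃[ N ] Q → ¬ AtLeast Q N → ∀ N′ → P ≃[ N′ ] Q
  ≃-beyond {N = N} P≃Q ¬Q≥N _ m _ with m ≤? N
  ... | yes m≤N = P≃Q m m≤N
  ... | no m≰N = mk⇔ (λ P≥m → contradiction (to (P≃Q N ≤-refl) (atLeast-≤ N≤m P≥m)) ¬Q≥N)
                       (λ Q≥m → contradiction (atLeast-≤ N≤m Q≥m) ¬Q≥N)
    where N≤m = <⇒≤ (≰⇒> m≰N)

  ∈-≃ : Unique xs → Unique ys → length xs ≡ length ys → (_∈ xs) ≃[ N ] (_∈ ys)
  ∈-≃ {xs = xs} {ys} ux uy len _ _ =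
    mk⇔ (λ xs≥ → atLeast-≤ (subst (_ ≤_) len (atLeast-∈⁻ xs≥)) (atLeast-∈⁺ uy))
        (λ ys≥ → atLeast-≤ (subst (_ ≤_) (sym len) (atLeast-∈⁻ ys≥)) (atLeast-∈⁺ ux))

  ≃⇒length≡ : Unique xs → Unique ys → (_∈ xs) ≃[ length xs ⊔ length ys ] (_∈ ys) → length xs ≡ length ys
  ≃⇒length≡ {xs = xs} {ys} ux uy xs≃ys = ≤-antisym
    (atLeast-∈⁻ (to (xs≃ys _ (m≤m⊔n _ _)) (atLeast-∈⁺ ux)))
    (atLeast-∈⁻ (from (xs≃ys _ (m≤n⊔m _ _)) (atLeast-∈⁺ uy)))

  ≃-∖ : P ≃[ N + length xs ] Q → Unique xs → All P xs → Unique ys → All Q ys → length xs ≡ length ys →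
        (P ∖ xs) ≃[ N ] (Q ∖ ys)
  ≃-∖ {N = N} {xs} {ys = ys} P≃Q ux pxs uy qys len m m≤N = mk⇔
    (λ Pxs≥ → atLeast-∖⁻ (subst (AtLeast _ ∘ (m +_)) len (to (P≃Q _ bound) (atLeast-∖⁺ ux pxs Pxs≥))))
    (λ Qys≥ → atLeast-∖⁻ (from (P≃Q _ bound) (subst (AtLeast _ ∘ (m +_)) (sym len) (atLeast-∖⁺ uy qys Qys≥))))
    where bound = +-monoˡ-≤ (length xs) m≤N

  copy : P ≃[ N ] Q → Unique xs → All P xs → length xs ≤ N →
         Σ (List A) λ ys → Unique ys × All Q ys × length ys ≡ length xs
  copy {xs = xs} P≃Q ux pxs len≤N = exactly (to (P≃Q _ len≤N) (xs , ux , pxs , ≤-refl))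

  truncSize : ℕ → Pred A 0ℓ → ℕ
  truncSize zero    P = 0
  truncSize (suc N) P with lem {AtLeast P (suc N)}
  ... | yes _ = suc N
  ... | no  _ = truncSize N P

  truncSize-≤ : ∀ N P → truncSize N P ≤ N
  truncSize-≤ zero    P = z≤n
  truncSize-≤ (suc N) P with lem {AtLeast P (suc N)}
  ... | yes _ = ≤-refl
  ... | no  _ = m≤n⇒m≤1+n (truncSize-≤ N P)

  atLeast⇔≤truncSize : m ≤ N → AtLeast P m ⇔ m ≤ truncSize N P
  atLeast⇔≤truncSize {N = zero} z≤n = mk⇔ (λ _ → z≤n) (λ _ → atLeast-zero)
  atLeast⇔≤truncSize {m} {suc N} {P} m≤N with lem {AtLeast P (suc N)}
  ... | yes P≥N = mk⇔ (λ _ → m≤N) (λ _ → atLeast-≤ m≤N P≥N)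
  ... | no ¬P≥N with m ≤? N
  ...   | yes m≤N′ = atLeast⇔≤truncSize m≤N′
  ...   | no  m≰N′ = mk⇔ (λ P≥m → contradiction (atLeast-≤ (≰⇒> m≰N′) P≥m) ¬P≥N)
                           (λ m≤t → contradiction (≤-trans m≤t (truncSize-≤ N P)) m≰N′)

  truncSize≡⇒≃ : truncSize N P ≡ truncSize N Q → P ≃[ N ] Q
  truncSize≡⇒≃ {P = P} {Q = Q} t≡t m m≤N =
    ⇔.trans (atLeast⇔≤truncSize m≤N) (⇔.trans (mk⇔ (subst (m ≤_) t≡t) (subst (m ≤_) (sym t≡t)))
                                                  (⇔.sym (atLeast⇔≤truncSize m≤N)))

  -- Once P v has fewer than v members, coherence pins the size of every P N to that of P v.
  module _ {D : Pred A 0ℓ} (P Q : ℕ → Pred A 0ℓ) (P⊆D : ∀ {N} → P N ⊆ D)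
           (Q⇔D∖P : ∀ {N x} → Q N x ⇔ (D x × ¬ P N x))
           (coherent : ∀ {N N′} → N ≤ N′ → P N′ ≃[ N ] P N × Q N′ ≃[ N ] Q N) where

    stabilise : ∀ v → ¬ AtLeast (P v) v →
                Σ (List A) λ xs → Unique xs × All D xs ×
                                  (∀ N → (_∈ xs) ≃[ N ] P N) × (∀ N → (D ∖ xs) ≃[ N ] Q N)
    stabilise v ¬Pv≥v with complete v ¬Pv≥v
    ... | ks , uk , pks , _ , P⊆ks = ks , uk , All.map P⊆D pks , ks≃P , D∖ks≃Q
      where
      ks≃Pv : ∀ {N} → (_∈ ks) ≃[ N ] P v
      ks≃Pv = ⊆⊇⇒≃ (All.lookup pks) P⊆ks

      far : ∀ N {N′} → P (N + v) ≃[ N′ ] P v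
      far N = ≃-beyond (proj₁ (coherent (m≤n+m v N))) ¬Pv≥v _

      ks≃P : ∀ N → (_∈ ks) ≃[ N ] P N
      ks≃P N = ≃-trans (≃-trans ks≃Pv (≃-sym (far N))) (proj₁ (coherent (m≤m+n N v)))

      D∖ks≃Q : ∀ N → (D ∖ ks) ≃[ N ] Q N
      D∖ks≃Q N with complete v (¬Pv≥v ∘ to (far N v ≤-refl))
      ... | ys , uy , pys , _ , P⊆ys =
        ≃-trans (≃-∖ ≃-refl uk (All.map P⊆D pks) uy (All.map P⊆D pys) len)
          (≃-trans (⊆⊇⇒≃ (λ (dx , x∉ys) → from Q⇔D∖P (dx , x∉ys ∘ P⊆ys))
                         (λ qx → let dx , ¬px = to Q⇔D∖P qx in dx , ¬px ∘ All.lookup pys))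
                   (proj₂ (coherent (m≤m+n N v))))
        where
        len : length ks ≡ length ys
        len = ≃⇒length≡ uk uy (≃-trans ks≃Pv (≃-trans (≃-sym (far N)) (⊆⊇⇒≃ P⊆ys (All.lookup pys))))

  copy-part : ∀ {F} → P ≃[ N + N ] Q → F ⊆ P → ¬ AtLeast F N →
              Σ (List A) λ ys → Unique ys × All Q ys × F ≃[ N ] (_∈ ys) × (λ x → P x × ¬ F x) ≃[ N ] (Q ∖ ys)
  copy-part {N = N} P≃Q F⊆P ¬F≥N with complete N ¬F≥N
  ... | xs , ux , fxs , len<N , F⊆xs with copy P≃Q ux (All.map F⊆P fxs) (≤-trans (<⇒≤ len<N) (m≤m+n N N))
  ...   | ys , uy , qys , len≡ =
    ys , uy , qys ,
    ≃-trans (⊆⊇⇒≃ F⊆xs (All.lookup fxs)) (∈-≃ ux uy (sym len≡)) ,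
    ≃-trans (⊆⊇⇒≃ (λ (px , ¬fx) → px , ¬fx ∘ All.lookup fxs) (λ (px , x∉xs) → px , x∉xs ∘ F⊆xs))
            (≃-∖ (≃-≤ (+-monoʳ-≤ N (<⇒≤ len<N)) P≃Q) ux (All.map F⊆P fxs) uy qys (sym len≡))

module Model (lem : ExcludedMiddle 0ℓ) {M : Set} (_⊑_ : M → M → Set) (isM : IsMereology _⊑_) where
  open Mereology _⊑_ isM
  open Counting lem {M}

  private
    dne = em⇒dne lem
    variable
      a x y z u : M
      xs : List M
      n : ℕ
      ρ ρ′ : Fin n → M
      s t : Vec Bool n
      N : ℕ

  ⊑-reflexive : x ≡ y → x ⊑ y
  ⊑-reflexive refl = ⊑-refl _

  ⊑𝟘⇒≡𝟘 : x ⊑ 𝟘 → x ≡ 𝟘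
  ⊑𝟘⇒≡𝟘 x⊑𝟘 = ⊑-antisym x⊑𝟘 (𝟘-least _)

  ⊑∩⇒ˡ : z ⊑ (x ∩ y) → z ⊑ x
  ⊑∩⇒ˡ z⊑x∩y = ⊑-trans z⊑x∩y (∩-lowerˡ _ _)

  ⊑∩⇒ʳ : z ⊑ (x ∩ y) → z ⊑ y
  ⊑∩⇒ʳ z⊑x∩y = ⊑-trans z⊑x∩y (∩-lowerʳ _ _)

  ⊑⇒∪ˡ : z ⊑ x → z ⊑ (x ∪ y)
  ⊑⇒∪ˡ z⊑x = ⊑-trans z⊑x (∪-upperˡ _ _)

  ⊑⇒∪ʳ : z ⊑ y → z ⊑ (x ∪ y)
  ⊑⇒∪ʳ z⊑y = ⊑-trans z⊑y (∪-upperʳ _ _)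

  Atoms : M → Pred M 0ℓ
  Atoms x a = IsAtom a × a ⊑ x

  atom-∪ : IsAtom a → a ⊑ (x ∪ y) → a ⊑ x ⊎ a ⊑ y
  atom-∪ {a} {x} {y} (a≢𝟘 , a-atom) a⊑x∪y
    with a-atom (a ∩ x) (∩-lowerˡ a x) | a-atom (a ∩ y) (∩-lowerˡ a y)
  ... | inj₂ a∩x≡a | _          = inj₁ (subst (_⊑ x) a∩x≡a (∩-lowerʳ a x))
  ... | inj₁ _     | inj₂ a∩y≡a = inj₂ (subst (_⊑ y) a∩y≡a (∩-lowerʳ a y))
  ... | inj₁ a∩x≡𝟘 | inj₁ a∩y≡𝟘 =
    contradiction (⊑𝟘⇒≡𝟘 (subst (_⊑ 𝟘) (sym a≡) (∪-least (⊑-reflexive a∩x≡𝟘) (⊑-reflexive a∩y≡𝟘)))) a≢𝟘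
    where
    a≡ : a ≡ (a ∩ x) ∪ (a ∩ y)
    a≡ = trans (⊑-antisym (∩-greatest (⊑-refl a) a⊑x∪y) (∩-lowerˡ a (x ∪ y))) (distrib a x y)

  atom-⊑-atom : IsAtom a → IsAtom x → a ⊑ x → a ≡ x
  atom-⊑-atom (a≢𝟘 , _) (_ , x-atom) a⊑x with x-atom _ a⊑x
  ... | inj₁ a≡𝟘 = contradiction a≡𝟘 a≢𝟘
  ... | inj₂ a≡x = a≡x

  atom-disjoint : Disjoint x y → IsAtom a → a ⊑ x → ¬ a ⊑ y
  atom-disjoint x∩y≡𝟘 (a≢𝟘 , _) a⊑x a⊑y =
    a≢𝟘 (⊑𝟘⇒≡𝟘 (subst (_ ⊑_) x∩y≡𝟘 (∩-greatest a⊑x a⊑y)))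

  ⋢⇒atom : ¬ x ⊑ y → Σ M λ a → Atoms x a × ¬ a ⊑ y
  ⋢⇒atom {x} {y} x⋢y with relCompl (𝟘-least (x ∩ y)) (∩-lowerˡ x y)
  ... | d , x∩y∩d≡𝟘 , x∩y∪d≡x with lem {d ≡ 𝟘}
  ...   | yes d≡𝟘 =
    contradiction (subst (_⊑ y) x∩y∪d≡x (∪-least (∩-lowerʳ x y) (subst (_⊑ y) (sym d≡𝟘) (𝟘-least y)))) x⋢y
  ...   | no d≢𝟘 with atomic d d≢𝟘
  ...     | a , a-atom , a⊑d =
    a , (a-atom , ⊑-trans a⊑d d⊑x) ,
    λ a⊑y → atom-disjoint x∩y∩d≡𝟘 a-atom (∩-greatest (⊑-trans a⊑d d⊑x) a⊑y) a⊑d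
    where
    d⊑x : d ⊑ x
    d⊑x = subst (d ⊑_) x∩y∪d≡x (∪-upperʳ _ d)

  atoms-⊑ : (∀ {a} → IsAtom a → a ⊑ x → a ⊑ y) → x ⊑ y
  atoms-⊑ {x} {y} atoms⊑ = dne λ x⋢y →
    let a , (a-atom , a⊑x) , a⋢y = ⋢⇒atom x⋢y in a⋢y (atoms⊑ a-atom a⊑x)

  atoms-≡ : (∀ {a} → IsAtom a → a ⊑ x ⇔ a ⊑ y) → x ≡ y
  atoms-≡ atoms⇔ = ⊑-antisym (atoms-⊑ (to ∘ atoms⇔)) (atoms-⊑ (from ∘ atoms⇔))

  atoms-𝟘 : (∀ {a} → IsAtom a → ¬ a ⊑ x) → x ≡ 𝟘
  atoms-𝟘 no-atoms = ⊑𝟘⇒≡𝟘 (atoms-⊑ λ a-atom a⊑x → contradiction a⊑x (no-atoms a-atom))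

  infixl 6 _−_
  _−_ : M → M → M
  x − y = proj₁ (relCompl (𝟘-least (x ∩ y)) (∩-lowerˡ x y))

  −-disjoint : ∀ x y → Disjoint (x ∩ y) (x − y)
  −-disjoint _ _ = proj₁ (proj₂ (relCompl (𝟘-least _) (∩-lowerˡ _ _)))

  −-covers : ∀ x y → (x ∩ y) ∪ (x − y) ≡ x
  −-covers _ _ = proj₂ (proj₂ (relCompl (𝟘-least _) (∩-lowerˡ _ _)))

  −-⊑ : ∀ x y → (x − y) ⊑ x
  −-⊑ x y = subst ((x − y) ⊑_) (−-covers x y) (∪-upperʳ _ _)

  atom-− : IsAtom a → a ⊑ (x − y) ⇔ (a ⊑ x × ¬ a ⊑ y)
  atom-− {a} {x} {y} a-atom = mk⇔
    (λ a⊑x−y → let a⊑x = ⊑-trans a⊑x−y (−-⊑ x y)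
               in a⊑x , λ a⊑y → atom-disjoint (−-disjoint x y) a-atom (∩-greatest a⊑x a⊑y) a⊑x−y)
    (λ (a⊑x , a⋢y) → [ (λ a⊑x∩y → contradiction (⊑∩⇒ʳ a⊑x∩y) a⋢y) , (λ a⊑x−y → a⊑x−y) ]′
                       (atom-∪ a-atom (subst (a ⊑_) (sym (−-covers x y)) a⊑x)))

  ⊑⋃ : x ∈ xs → x ⊑ ⋃ xs
  ⊑⋃ (here refl) = ∪-upperˡ _ _
  ⊑⋃ (there x∈xs) = ⊑⇒∪ʳ (⊑⋃ x∈xs)

  ⋃⊑ : All (_⊑ z) xs → ⋃ xs ⊑ z
  ⋃⊑ []             = 𝟘-least _
  ⋃⊑ (x⊑z ∷ xs⊑z) = ∪-least x⊑z (⋃⊑ xs⊑z)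

  atom-⋃-atoms : All IsAtom xs → IsAtom a → a ⊑ ⋃ xs ⇔ a ∈ xs
  atom-⋃-atoms atoms a-atom = mk⇔ (⊑⋃⇒∈ atoms a-atom) ⊑⋃
    where
    ⊑⋃⇒∈ : All IsAtom xs → IsAtom a → a ⊑ ⋃ xs → a ∈ xs
    ⊑⋃⇒∈ [] (a≢𝟘 , _) a⊑𝟘 = contradiction (⊑𝟘⇒≡𝟘 a⊑𝟘) a≢𝟘
    ⊑⋃⇒∈ (x-atom ∷ atoms) a-atom a⊑⋃ with atom-∪ a-atom a⊑⋃
    ... | inj₁ a⊑x  = here (atom-⊑-atom a-atom x-atom a⊑x)
    ... | inj₂ a⊑⋃′ = there (⊑⋃⇒∈ atoms a-atom a⊑⋃′)

  infinite⇒atLeast : Infinite u → ∀ m → AtLeast (Atoms u) m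
  infinite⇒atLeast {u} u-inf m = dne λ ¬u≥m →
    let xs , _ , xs-atoms , _ , atoms⊆xs = complete m ¬u≥m
        atoms = All.map proj₁ xs-atoms
    in u-inf (xs , atoms , atoms-≡ λ a-atom →
         mk⇔ (λ a⊑u → ⊑⋃ (atoms⊆xs (a-atom , a⊑u)))
             (λ a⊑⋃ → proj₂ (All.lookup xs-atoms (to (atom-⋃-atoms atoms a-atom) a⊑⋃))))

  atLeast⇒infinite : (∀ m → AtLeast (Atoms u) m) → Infinite u
  atLeast⇒infinite {u} u≥ (xs , atoms , u≡⋃xs) =
    1+n≰n (atLeast-∈⁻ (atLeast-⊆ (λ (a-atom , a⊑u) → to (atom-⋃-atoms atoms a-atom) (subst (_ ⊑_) u≡⋃xs a⊑u))
                                 (u≥ (suc (length xs)))))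

  atoms-outside : ∀ z m → AtLeast (λ a → IsAtom a × ¬ a ⊑ z) m
  atoms-outside z zero = atLeast-zero
  atoms-outside z (suc m) with atoms-outside z m
  ... | xs , u , xs-out , m≤ with unbounded (z ∪ ⋃ xs)
  ...   | y , y⋢ with ⋢⇒atom y⋢
  ...     | a , (a-atom , _) , a⋢ =
    atLeast-≤ (s≤s m≤) (atLeast-∷ (a-atom , a⋢ ∘ ⊑⇒∪ˡ) (a⋢ ∘ ⊑⇒∪ʳ ∘ ⊑⋃) u xs-out)

  Holds : Bool → Set → Set
  Holds true  P = P
  Holds false P = ¬ P

  -- Cell ρ s is the class of atoms a with a ⊑ ρ i exactly when s has true at i.
  Cell : ∀ {n} → (Fin n → M) → Vec Bool n → Pred M 0ℓ
  Cell {zero}  ρ []      a = IsAtom a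
  Cell {suc n} ρ (b ∷ s) a = Holds b (a ⊑ ρ zero) × Cell (ρ ∘ suc) s a

  Inside Outside : Pred M 0ℓ → M → Pred M 0ℓ
  Inside  A p a = a ⊑ p × A a
  Outside A p a = ¬ a ⊑ p × A a

  cell-atom : Cell ρ s a → IsAtom a
  cell-atom {s = []}    a-atom     = a-atom
  cell-atom {s = _ ∷ _} (_ , cell) = cell-atom cell

  cell-lookup : Cell ρ s a → ∀ i → Holds (lookup s i) (a ⊑ ρ i)
  cell-lookup {s = _ ∷ _} (holds , _)  zero    = holds
  cell-lookup {s = _ ∷ _} (_ , cell)   (suc i) = cell-lookup cell i

  cell-of : IsAtom a → (ρ : Fin n → M) → Σ (Vec Bool n) λ s → Cell ρ s a
  cell-of {n = zero}  a-atom ρ = [] , a-atom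
  cell-of {n = suc n} a-atom ρ with cell-of a-atom (ρ ∘ suc) | lem {_ ⊑ ρ zero}
  ... | s , cell | yes a⊑ρ₀ = true  ∷ s , a⊑ρ₀ , cell
  ... | s , cell | no  a⋢ρ₀ = false ∷ s , a⋢ρ₀ , cell

  holds-unique : ∀ {b c P} → Holds b P → Holds c P → b ≡ c
  holds-unique {true}  {true}  _  _  = refl
  holds-unique {false} {false} _  _  = refl
  holds-unique {true}  {false} p  ¬p = contradiction p ¬p
  holds-unique {false} {true}  ¬p p  = contradiction p ¬p

  holds-transfer : ∀ {b P Q} → Holds b P → Holds b Q → P → Q
  holds-transfer {true}  _  q _ = q
  holds-transfer {false} ¬p _ p = contradiction p ¬p

  cell-unique : Cell ρ s a → Cell ρ t a → s ≡ t
  cell-unique {s = []}    {t = []}    _          _            = refl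
  cell-unique {s = _ ∷ _} {t = _ ∷ _} (h , cell) (h′ , cell′) =
    cong₂ _∷_ (holds-unique h h′) (cell-unique cell cell′)

  cell-transfer : Cell ρ s a → Cell ρ′ s y → ∀ i → a ⊑ ρ i → y ⊑ ρ′ i
  cell-transfer cell cell′ i = holds-transfer (cell-lookup cell i) (cell-lookup cell′ i)

  cell-⊑ : ∀ i → lookup s i ≡ true → Cell ρ s a → a ⊑ ρ i
  cell-⊑ i sᵢ≡true cell = subst (λ b → Holds b _) sᵢ≡true (cell-lookup cell i)

  cellBelow : (Fin n → M) → Vec Bool n → M → M
  cellBelow ρ []          e = e
  cellBelow ρ (true  ∷ s) e = cellBelow (ρ ∘ suc) s (e ∩ ρ zero)
  cellBelow ρ (false ∷ s) e = cellBelow (ρ ∘ suc) s (e − ρ zero)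

  atom-cellBelow : ∀ s e → IsAtom a → a ⊑ cellBelow ρ s e ⇔ (a ⊑ e × Cell ρ s a)
  atom-cellBelow []          e a-atom = mk⇔ (_, a-atom) proj₁
  atom-cellBelow {ρ = ρ} (true ∷ s) e a-atom with atom-cellBelow {ρ = ρ ∘ suc} s (e ∩ ρ zero) a-atom
  ... | ih = mk⇔ (λ a⊑ → let a⊑e∩ρ₀ , cell = to ih a⊑ in ⊑∩⇒ˡ a⊑e∩ρ₀ , ⊑∩⇒ʳ a⊑e∩ρ₀ , cell)
                 (λ (a⊑e , a⊑ρ₀ , cell) → from ih (∩-greatest a⊑e a⊑ρ₀ , cell))
  atom-cellBelow {ρ = ρ} (false ∷ s) e a-atom with atom-cellBelow {ρ = ρ ∘ suc} s (e − ρ zero) a-atom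
  ... | ih = mk⇔ (λ a⊑ → let a⊑e−ρ₀ , cell = to ih a⊑
                             a⊑e , a⋢ρ₀ = to (atom-− a-atom) a⊑e−ρ₀
                         in a⊑e , a⋢ρ₀ , cell)
                 (λ (a⊑e , a⋢ρ₀ , cell) → from ih (from (atom-− a-atom) (a⊑e , a⋢ρ₀) , cell))

  cellElement : ∀ i → lookup s i ≡ true → Σ M λ E → ∀ {a} → Atoms E a ⇔ Cell ρ s a
  cellElement {s = s} {ρ = ρ} i sᵢ≡true = cellBelow ρ s (ρ i) , mk⇔
    (λ (a-atom , a⊑) → proj₂ (to (atom-cellBelow s (ρ i) a-atom) a⊑))
    (λ cell → cell-atom cell , from (atom-cellBelow s (ρ i) (cell-atom cell)) (cell-⊑ i sᵢ≡true cell , cell))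

  ⋁ : (Vec Bool n → M) → M
  ⋁ {zero}  q = q []
  ⋁ {suc n} q = ⋁ (q ∘ (true ∷_)) ∪ ⋁ (q ∘ (false ∷_))

  ⊑⋁ : ∀ (q : Vec Bool n → M) s → q s ⊑ ⋁ q
  ⊑⋁ q []          = ⊑-refl _
  ⊑⋁ q (true  ∷ s) = ⊑⇒∪ˡ (⊑⋁ (q ∘ (true ∷_)) s)
  ⊑⋁ q (false ∷ s) = ⊑⇒∪ʳ (⊑⋁ (q ∘ (false ∷_)) s)

  atom-⋁ : ∀ (q : Vec Bool n → M) → IsAtom a → a ⊑ ⋁ q → Σ (Vec Bool n) λ s → a ⊑ q s
  atom-⋁ {zero}  q a-atom a⊑ = [] , a⊑
  atom-⋁ {suc n} q a-atom a⊑ with atom-∪ a-atom a⊑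
  ... | inj₁ a⊑ᵗ = let s , a⊑qs = atom-⋁ (q ∘ (true ∷_)) a-atom a⊑ᵗ in true ∷ s , a⊑qs
  ... | inj₂ a⊑ᶠ = let s , a⊑qs = atom-⋁ (q ∘ (false ∷_)) a-atom a⊑ᶠ in false ∷ s , a⊑qs

  cell-⋁ : ∀ (q : Vec Bool n → M) → (∀ s → Atoms (q s) ⊆ Cell ρ s) → Cell ρ s a → a ⊑ ⋁ q ⇔ a ⊑ q s
  cell-⋁ q q⊆cell cell = mk⇔
    (λ a⊑ → let t , a⊑qt = atom-⋁ q (cell-atom cell) a⊑
            in subst (λ t → _ ⊑ q t) (cell-unique (q⊆cell t (cell-atom cell , a⊑qt)) cell) a⊑qt)
    (λ a⊑qs → ⊑-trans a⊑qs (⊑⋁ q _))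

  cell-outside : ¬ (Σ (Fin n) λ i → lookup s i ≡ true) → IsAtom a → ¬ a ⊑ ⋃ (tabulate ρ) → Cell ρ s a
  cell-outside {s = []}        _     a-atom _  = a-atom
  cell-outside {s = true  ∷ _} ¬true _      _  = contradiction (zero , refl) ¬true
  cell-outside {s = false ∷ _} ¬true a-atom a⋢ =
    a⋢ ∘ ⊑⇒∪ˡ , cell-outside (λ (i , sᵢ) → ¬true (suc i , sᵢ)) a-atom (a⋢ ∘ ⊑⇒∪ʳ)

  outside-unbounded : ¬ (Σ (Fin n) λ i → lookup s i ≡ true) → ∀ y m → AtLeast (Outside (Cell ρ s) y) m
  outside-unbounded {ρ = ρ} ¬true y m = atLeast-⊆
    (λ (a-atom , a⋢) → a⋢ ∘ ⊑⇒∪ˡ , cell-outside ¬true a-atom (a⋢ ∘ ⊑⇒∪ʳ))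
    (atoms-outside (y ∪ ⋃ (tabulate ρ)) m)

  Piece : (A X C : Pred M 0ℓ) → ℕ → M → Set
  Piece A X C N q = Atoms q ⊆ A × X ≃[ N ] Inside A q × C ≃[ N ] Outside A q

  module _ {A : Pred M 0ℓ} (A⊆atoms : A ⊆ IsAtom) {X C : Pred M 0ℓ} {N : ℕ} where

    ⋃-piece : All A xs → X ≃[ N ] (_∈ xs) → C ≃[ N ] (A ∖ xs) → Piece A X C N (⋃ xs)
    ⋃-piece {xs} Axs X≃xs C≃A∖xs =
      (λ (a-atom , a⊑) → All.lookup Axs (⊑⋃⇒∈ a-atom a⊑)) ,
      ≃-trans X≃xs (⊆⊇⇒≃ (λ a∈ → ⊑⋃ a∈ , All.lookup Axs a∈)
                         (λ (a⊑ , Aa) → ⊑⋃⇒∈ (A⊆atoms Aa) a⊑)) ,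
      ≃-trans C≃A∖xs (⊆⊇⇒≃ (λ (Aa , a∉) → a∉ ∘ ⊑⋃⇒∈ (A⊆atoms Aa) , Aa)
                           (λ (a⋢ , Aa) → Aa , a⋢ ∘ ⊑⋃))
      where
      ⊑⋃⇒∈ : IsAtom a → a ⊑ ⋃ xs → a ∈ xs
      ⊑⋃⇒∈ a-atom = to (atom-⋃-atoms (All.map A⊆atoms Axs) a-atom)

    −⋃-piece : ∀ {E} → (∀ {a} → Atoms E a ⇔ A a) → All A xs → X ≃[ N ] (A ∖ xs) → C ≃[ N ] (_∈ xs) →
               Piece A X C N (E − ⋃ xs)
    −⋃-piece {xs} {E} E≐A Axs X≃A∖xs C≃xs =
      (λ (a-atom , a⊑) → to E≐A (a-atom , ⊑-trans a⊑ (−-⊑ E (⋃ xs)))) ,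
      ≃-trans X≃A∖xs (⊆⊇⇒≃ (λ (Aa , a∉) → inside Aa a∉ , Aa)
                           (λ (a⊑ , Aa) → Aa , λ a∈ → proj₂ (⊑−⇒ Aa a⊑) (⊑⋃ a∈))) ,
      ≃-trans C≃xs (⊆⊇⇒≃ (λ a∈ → (λ a⊑ → proj₂ (⊑−⇒ (All.lookup Axs a∈) a⊑) (⊑⋃ a∈)) ,
                                 All.lookup Axs a∈)
                         (λ (a⋢ , Aa) → dne λ a∉ → a⋢ (inside Aa a∉)))
      where
      ⊑−⇒ : A a → a ⊑ (E − ⋃ xs) → a ⊑ E × ¬ a ⊑ ⋃ xs
      ⊑−⇒ Aa = to (atom-− (A⊆atoms Aa))

      inside : A a → a ∉ xs → a ⊑ (E − ⋃ xs)
      inside Aa a∉ = from (atom-− (A⊆atoms Aa))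
        (proj₂ (from E≐A Aa) , a∉ ∘ to (atom-⋃-atoms (All.map A⊆atoms Axs) (A⊆atoms Aa)))

  Outside⇔ : ∀ {A p} → Outside A p a ⇔ (A a × ¬ Inside A p a)
  Outside⇔ = mk⇔ (λ (a⋢p , Aa) → Aa , a⋢p ∘ proj₁) (λ (Aa , ¬in) → (λ a⊑p → ¬in (a⊑p , Aa)) , Aa)

  Inside⇔ : ∀ {A p} → Inside A p a ⇔ (A a × ¬ Outside A p a)
  Inside⇔ = mk⇔ (λ (a⊑p , Aa) → Aa , λ (a⋢p , _) → a⋢p a⊑p)
                (λ (Aa , ¬out) → dne (λ a⋢p → ¬out (a⋢p , Aa)) , Aa)

  -- Whichever of the inside and the outside of y in A is small is copied into A′; when both are
  -- large, any N atoms of A′ will do.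
  piece-step : ∀ {A A′ N} → A ⊆ IsAtom → A′ ⊆ IsAtom → A ≃[ N + N ] A′ →
               (Σ M λ E → ∀ {a} → Atoms E a ⇔ A′ a) ⊎ (∀ m → AtLeast (Outside A y) m) →
               Σ M (Piece A′ (Inside A y) (Outside A y) N)
  piece-step {y} {A} {A′} {N} A⊆atoms A′⊆atoms A≃A′ carrier
    with lem {AtLeast (Inside A y) N} | lem {AtLeast (Outside A y) N}
  ... | yes many-in | yes many-out =
    let A′≥2N = to (A≃A′ (N + N) ≤-refl)
                  (atLeast-⊆ [ proj₂ , proj₂ ]′ (atLeast-+ (λ (a⊑y , _) (a⋢y , _) → a⋢y a⊑y) many-in many-out))
        ys , uy , A′ys , len≡N = exactly (atLeast-≤ (m≤m+n N N) A′≥2N)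
    in ⋃ ys , ⋃-piece A′⊆atoms A′ys
                (atLeast⇒≃ many-in (subst (AtLeast _) len≡N (atLeast-∈⁺ uy)))
                (atLeast⇒≃ many-out (atLeast-∖⁻ (subst (λ k → AtLeast A′ (N + k)) (sym len≡N) A′≥2N)))
  ... | no few-in | _ =
    let ys , _ , A′ys , in≃ys , rest≃ = copy-part A≃A′ proj₂ few-in
    in ⋃ ys , ⋃-piece A′⊆atoms A′ys in≃ys
                (≃-trans (⇔⇒≃ (Outside⇔ {A = A})) rest≃)
  ... | yes _ | no few-out with carrier
  ...   | inj₂ out-unbounded = contradiction (out-unbounded N) few-out
  ...   | inj₁ (E , E≐A′) =
    let ys , _ , A′ys , out≃ys , rest≃ = copy-part A≃A′ proj₂ few-out
    in E − ⋃ ys , −⋃-piece A′⊆atoms E≐A′ A′ys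
                    (≃-trans (⇔⇒≃ (Inside⇔ {A = A})) rest≃)
                    out≃ys

  infix 4 _≈[_]_
  _≈[_]_ : (Fin n → M) → ℕ → (Fin n → M) → Set
  ρ ≈[ N ] ρ′ = ∀ s → Cell ρ s ≃[ N ] Cell ρ′ s

  ≈-sym : ρ ≈[ N ] ρ′ → ρ′ ≈[ N ] ρ
  ≈-sym ρ≈ρ′ s = ≃-sym (ρ≈ρ′ s)

  ≈-trans : ∀ {ρ″ : Fin n → M} → ρ ≈[ N ] ρ′ → ρ′ ≈[ N ] ρ″ → ρ ≈[ N ] ρ″
  ≈-trans ρ≈ρ′ ρ′≈ρ″ s = ≃-trans (ρ≈ρ′ s) (ρ′≈ρ″ s)

  ≈-≤ : ∀ {m} → m ≤ N → ρ ≈[ N ] ρ′ → ρ ≈[ m ] ρ′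
  ≈-≤ m≤N ρ≈ρ′ s = ≃-≤ m≤N (ρ≈ρ′ s)

  ≈-⊑ : 1 ≤ N → ρ ≈[ N ] ρ′ → ∀ i j → ρ i ⊑ ρ j → ρ′ i ⊑ ρ′ j
  ≈-⊑ {ρ = ρ} {ρ′ = ρ′} 1≤N ρ≈ρ′ i j ρi⊑ρj = atoms-⊑ λ a-atom a⊑ρ′i → dne λ a⋢ρ′j →
    let s , a-cell = cell-of a-atom ρ′
        b , b-cell = to atLeast-1 (from (ρ≈ρ′ s 1 1≤N) (from atLeast-1 (_ , a-cell)))
        b⊑ρj = ⊑-trans (cell-transfer a-cell b-cell i a⊑ρ′i) ρi⊑ρj
    in a⋢ρ′j (cell-transfer b-cell a-cell j b⊑ρj)

  ≈-∷ : (q : Vec Bool n → M) →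
        (∀ s → Piece (Cell ρ′ s) (Inside (Cell ρ s) y) (Outside (Cell ρ s) y) N (q s)) →
        (y ∷ₑ ρ) ≈[ N ] (⋁ q ∷ₑ ρ′)
  ≈-∷ q pieces (true ∷ s) =
    ≃-trans (proj₁ (proj₂ (pieces s)))
            (⊆⊇⇒≃ (λ (a⊑qs , cell) → from (cell-⋁ q (proj₁ ∘ pieces) cell) a⊑qs , cell)
                  (λ (a⊑⋁q , cell) → to (cell-⋁ q (proj₁ ∘ pieces) cell) a⊑⋁q , cell))
  ≈-∷ q pieces (false ∷ s) =
    ≃-trans (proj₂ (proj₂ (pieces s)))
            (⊆⊇⇒≃ (λ (a⋢qs , cell) → a⋢qs ∘ to (cell-⋁ q (proj₁ ∘ pieces) cell) , cell)
                  (λ (a⋢⋁q , cell) → a⋢⋁q ∘ from (cell-⋁ q (proj₁ ∘ pieces) cell) , cell))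

  ≈-step : ρ ≈[ N + N ] ρ′ → ∀ y → Σ M λ y′ → (y ∷ₑ ρ) ≈[ N ] (y′ ∷ₑ ρ′)
  ≈-step {n} {ρ} {N} {ρ′} ρ≈ρ′ y = ⋁ (proj₁ ∘ piece) , ≈-∷ (proj₁ ∘ piece) (proj₂ ∘ piece)
    where
    piece : ∀ s → Σ M (Piece (Cell ρ′ s) (Inside (Cell ρ s) y) (Outside (Cell ρ s) y) N)
    piece s with any? (λ i → lookup s i Bool.≟ true)
    ... | yes (i , sᵢ≡true) = piece-step cell-atom cell-atom (ρ≈ρ′ s) (inj₁ (cellElement i sᵢ≡true))
    ... | no ¬true          = piece-step cell-atom cell-atom (ρ≈ρ′ s) (inj₂ (outside-unbounded ¬true y))

  depth : Formula n → ℕ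
  depth (_ ⊑' _) = 0
  depth (_ ≐ _)  = 0
  depth ⊥'       = 0
  depth (φ ⇒ ψ)  = depth φ + depth ψ
  depth (φ ∧' ψ) = depth φ + depth ψ
  depth (φ ∨' ψ) = depth φ + depth ψ
  depth (∀' φ)   = suc (depth φ)
  depth (∃' φ)   = suc (depth φ)

  private
    ≈-left : ∀ a b → ρ ≈[ 2 ^ (a + b) ] ρ′ → ρ ≈[ 2 ^ a ] ρ′
    ≈-left a b = ≈-≤ (^-monoʳ-≤ 2 (m≤m+n a b))

    ≈-right : ∀ a b → ρ ≈[ 2 ^ (a + b) ] ρ′ → ρ ≈[ 2 ^ b ] ρ′
    ≈-right a b = ≈-≤ (^-monoʳ-≤ 2 (m≤n+m b a))

    ≈-halve : ∀ a → ρ ≈[ 2 ^ suc a ] ρ′ → ρ ≈[ 2 ^ a + 2 ^ a ] ρ′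
    ≈-halve a = ≈-≤ (≤-reflexive (cong (2 ^ a +_) (sym (+-identityʳ (2 ^ a)))))

  ≈-Sat : ∀ (φ : Formula n) → ρ ≈[ 2 ^ depth φ ] ρ′ → Sat _⊑_ ρ φ → Sat _⊑_ ρ′ φ
  ≈-Sat (i ⊑' j) ρ≈ρ′ = ≈-⊑ ≤-refl ρ≈ρ′ i j
  ≈-Sat (i ≐ j)  ρ≈ρ′ ρi≡ρj =
    ⊑-antisym (≈-⊑ ≤-refl ρ≈ρ′ i j (⊑-reflexive ρi≡ρj))
              (≈-⊑ ≤-refl ρ≈ρ′ j i (⊑-reflexive (sym ρi≡ρj)))
  ≈-Sat (φ ⇒ ψ)  ρ≈ρ′ φ⇒ψ =
    ≈-Sat ψ (≈-right (depth φ) (depth ψ) ρ≈ρ′) ∘ φ⇒ψ ∘ ≈-Sat φ (≈-sym (≈-left (depth φ) (depth ψ) ρ≈ρ′))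
  ≈-Sat (φ ∧' ψ) ρ≈ρ′ (sφ , sψ) =
    ≈-Sat φ (≈-left (depth φ) (depth ψ) ρ≈ρ′) sφ , ≈-Sat ψ (≈-right (depth φ) (depth ψ) ρ≈ρ′) sψ
  ≈-Sat (φ ∨' ψ) ρ≈ρ′ (inj₁ sφ) = inj₁ (≈-Sat φ (≈-left (depth φ) (depth ψ) ρ≈ρ′) sφ)
  ≈-Sat (φ ∨' ψ) ρ≈ρ′ (inj₂ sψ) = inj₂ (≈-Sat ψ (≈-right (depth φ) (depth ψ) ρ≈ρ′) sψ)
  ≈-Sat (∀' φ) ρ≈ρ′ ∀φ y′ =
    let y , yρ≈y′ρ′ = ≈-step (≈-sym (≈-halve (depth φ) ρ≈ρ′)) y′
    in ≈-Sat φ (≈-sym yρ≈y′ρ′) (∀φ y)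
  ≈-Sat (∃' φ) ρ≈ρ′ (y , sφ) =
    let y′ , yρ≈y′ρ′ = ≈-step (≈-halve (depth φ) ρ≈ρ′) y
    in y′ , ≈-Sat φ yρ≈y′ρ′ sφ

  infinite-piece : ∀ {A X C q} → Atoms q ⊆ A → Infinite q → (∀ m → AtLeast (Outside A q) m) →
                   AtLeast X N → AtLeast C N → Piece A X C N q
  infinite-piece {N = N} q⊆A q-inf out-unbounded X≥N C≥N =
    q⊆A ,
    atLeast⇒≃ X≥N (atLeast-⊆ (λ q-atom → proj₂ q-atom , q⊆A q-atom) (infinite⇒atLeast q-inf N)) ,
    atLeast⇒≃ C≥N (out-unbounded N)

  InfiniteSplitting : Set
  InfiniteSplitting =
    ∀ u → Infinite u → Σ M λ v → Σ M λ w → Infinite v × Infinite w × Disjoint v w × (u ≡ (v ∪ w))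

  InfiniteAvoidance : Set
  InfiniteAvoidance = ∀ a → Σ M λ u → Infinite u × Disjoint u a

  module Limit (split : InfiniteSplitting) (avoid : InfiniteAvoidance) {k : ℕ} (a : Fin k → M) (xs : ℕ → M)
               (coherent : ∀ {N N′} → N ≤ N′ → (xs N′ ∷ₑ a) ≈[ N ] (xs N ∷ₑ a)) where

    In Out : Vec Bool k → ℕ → Pred M 0ℓ
    In  t N = Inside  (Cell a t) (xs N)
    Out t N = Outside (Cell a t) (xs N)

    LimitPiece : Vec Bool k → M → Set
    LimitPiece t q = ∀ N → Piece (Cell a t) (In t N) (Out t N) N q

    few-in-piece : ∀ {t} v → ¬ AtLeast (In t v) v → Σ M (LimitPiece t)
    few-in-piece {t} v few-in =
      let ks , _ , cell-ks , ks≃In , rest≃Out =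
            stabilise {D = Cell a t} (In t) (Out t) proj₂ (Outside⇔ {A = Cell a t})
                      (λ N≤N′ → coherent N≤N′ (true ∷ t) , coherent N≤N′ (false ∷ t)) v few-in
      in ⋃ ks , λ N → ⋃-piece cell-atom cell-ks (≃-sym (ks≃In N)) (≃-sym (rest≃Out N))

    few-out-piece : ∀ {t} i → lookup t i ≡ true → ∀ v → ¬ AtLeast (Out t v) v → Σ M (LimitPiece t)
    few-out-piece {t} i tᵢ≡true v few-out =
      let E , E≐cell = cellElement i tᵢ≡true
          ks , _ , cell-ks , ks≃Out , rest≃In =
            stabilise {D = Cell a t} (Out t) (In t) proj₂ (Inside⇔ {A = Cell a t})
                      (λ N≤N′ → coherent N≤N′ (false ∷ t) , coherent N≤N′ (true ∷ t)) v few-out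
      in E − ⋃ ks , λ N → −⋃-piece cell-atom E≐cell cell-ks (≃-sym (rest≃In N)) (≃-sym (ks≃Out N))

    split-piece : ∀ {t} i → lookup t i ≡ true → (∀ m → AtLeast (In t m) m) → (∀ m → AtLeast (Out t m) m) →
                  Σ M (LimitPiece t)
    split-piece {t} i tᵢ≡true many-in many-out with cellElement i tᵢ≡true
    ... | E , E≐cell with split E (atLeast⇒infinite λ m → atLeast-⊆ (from E≐cell ∘ proj₂) (many-in m))
    ...   | v , w , v-inf , w-inf , v∩w≡𝟘 , E≡v∪w =
      v , λ N → infinite-piece v⊆cell v-inf outside-v (many-in N) (many-out N)
      where
      ⊑E : ∀ {b} → b ⊑ (v ∪ w) → b ⊑ E
      ⊑E = subst (_ ⊑_) (sym E≡v∪w)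

      v⊆cell : Atoms v ⊆ Cell a t
      v⊆cell (b-atom , b⊑v) = to E≐cell (b-atom , ⊑E (⊑⇒∪ˡ b⊑v))

      outside-v : ∀ m → AtLeast (Outside (Cell a t) v) m
      outside-v m = atLeast-⊆ (λ (b-atom , b⊑w) → (λ b⊑v → atom-disjoint v∩w≡𝟘 b-atom b⊑v b⊑w) ,
                                                  to E≐cell (b-atom , ⊑E (⊑⇒∪ʳ b⊑w)))
                              (infinite⇒atLeast w-inf m)

    avoid-piece : ∀ {t} → ¬ (Σ (Fin k) λ i → lookup t i ≡ true) →
                  (∀ m → AtLeast (In t m) m) → (∀ m → AtLeast (Out t m) m) → Σ M (LimitPiece t)
    avoid-piece {t} ¬true many-in many-out with avoid (⋃ (tabulate a))
    ... | u , u-inf , u∩a≡𝟘 = u , λ N → infinite-piece u⊆cell u-inf (outside-unbounded ¬true u) (many-in N) (many-out N)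
      where
      u⊆cell : Atoms u ⊆ Cell a t
      u⊆cell (b-atom , b⊑u) = cell-outside ¬true b-atom (atom-disjoint u∩a≡𝟘 b-atom b⊑u)

    sizes-unbounded : ∀ {P : ℕ → Pred M 0ℓ} → ¬ (Σ ℕ λ v → ¬ AtLeast (P v) v) → ∀ m → AtLeast (P m) m
    sizes-unbounded ¬few m = dne λ few → ¬few (m , few)

    limit-piece : ∀ t → Σ M (LimitPiece t)
    limit-piece t with lem {Σ ℕ λ v → ¬ AtLeast (In t v) v} | lem {Σ ℕ λ v → ¬ AtLeast (Out t v) v}
                     | any? (λ i → lookup t i Bool.≟ true)
    ... | yes (v , few-in) | _                 | _                  = few-in-piece v few-in
    ... | no _             | yes (v , few-out) | yes (i , tᵢ≡true)  = few-out-piece i tᵢ≡true v few-out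
    ... | no _             | yes (v , few-out) | no ¬true           = contradiction (outside-unbounded ¬true (xs v) v) few-out
    ... | no ¬few-in       | no ¬few-out       | yes (i , tᵢ≡true)  =
      split-piece i tᵢ≡true (sizes-unbounded ¬few-in) (sizes-unbounded ¬few-out)
    ... | no ¬few-in       | no ¬few-out       | no ¬true           =
      avoid-piece ¬true (sizes-unbounded ¬few-in) (sizes-unbounded ¬few-out)

    limit : M
    limit = ⋁ (proj₁ ∘ limit-piece)

    ≈-limit : ∀ N → (xs N ∷ₑ a) ≈[ N ] (limit ∷ₑ a)
    ≈-limit N = ≈-∷ (proj₁ ∘ limit-piece) (λ t → proj₂ (limit-piece t) N)

  ≈-refl : ρ ≈[ N ] ρ
  ≈-refl s = ≃-refl

  module Saturation (split : InfiniteSplitting) (avoid : InfiniteAvoidance) {k : ℕ} (a : Fin k → M)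
                    (p : OneType k) (p-finSat : FinitelySatisfiable _⊑_ a p) where

    SatisfiableIn : Pred M 0ℓ → Set
    SatisfiableIn C = ∀ φs → All p φs → Σ M λ z → C z × Realizes _⊑_ a z φs

    satisfiableIn-⊆ : ∀ {C D : Pred M 0ℓ} → C ⊆ D → SatisfiableIn C → SatisfiableIn D
    satisfiableIn-⊆ C⊆D sat φs pφs = let z , Cz , rz = sat φs pφs in z , C⊆D Cz , rz

    satisfiableIn-∪ : ∀ {C D D′ : Pred M 0ℓ} → SatisfiableIn C → (∀ {z} → C z → D z ⊎ D′ z) →
                      SatisfiableIn (λ z → C z × D z) ⊎ SatisfiableIn (λ z → C z × D′ z)
    satisfiableIn-∪ {C} {D} {D′} sat cover with lem {SatisfiableIn (λ z → C z × D z)}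
    ... | yes satD = inj₁ satD
    ... | no ¬satD = inj₂ λ φs pφs → dne λ ¬φs → ¬satD λ ψs pψs → dne λ ¬ψs →
      let z , Cz , rz = sat (ψs ++ φs) (++⁺ pψs pφs)
      in [ (λ Dz → ¬ψs (z , (Cz , Dz) , ++⁻ˡ ψs rz)) ,
           (λ D′z → ¬φs (z , (Cz , D′z) , ++⁻ʳ ψs rz)) ]′ (cover Cz)

    satisfiableIn-cover : ∀ {C : Pred M 0ℓ} {V : Set} {D : V → Pred M 0ℓ} vs → SatisfiableIn C →
                          (∀ {z} → C z → Any (λ v → D v z) vs) → Σ V λ v → SatisfiableIn (λ z → C z × D v z)
    satisfiableIn-cover [] sat cover with sat [] []
    ... | _ , Cz , _ with cover Cz
    ... | ()
    satisfiableIn-cover {D = D} (v ∷ vs) sat cover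
      with satisfiableIn-∪ {D = D v} {D′ = λ z → Any (λ v → D v z) vs} sat (Any.toSum ∘ cover)
    ... | inj₁ satv = v , satv
    ... | inj₂ satvs = let v′ , satv′ = satisfiableIn-cover {D = D} vs satvs proj₂
                       in v′ , satisfiableIn-⊆ (λ ((Cz , _) , Dz) → Cz , Dz) satv′

    satisfiableIn-constant : ∀ {C : Pred M 0ℓ} {n} N (g : M → Vec Bool n → ℕ) → (∀ z s → g z s ≤ N) →
                             SatisfiableIn C →
                             Σ (Vec Bool n → ℕ) λ v → SatisfiableIn (λ z → C z × ∀ s → g z s ≡ v s)
    satisfiableIn-constant {n = zero} N g g≤N sat
      with satisfiableIn-cover {D = λ v z → g z [] ≡ v} (upTo (suc N)) sat (λ {z} _ → ∈-upTo⁺ (s≤s (g≤N z [])))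
    ... | v , satv = (λ _ → v) , satisfiableIn-⊆ (λ (Cz , gz≡v) → Cz , λ { [] → gz≡v }) satv
    satisfiableIn-constant {n = suc n} N g g≤N sat
      with satisfiableIn-constant N (λ z s → g z (true ∷ s)) (λ z s → g≤N z (true ∷ s)) sat
    ... | v₁ , sat₁ with satisfiableIn-constant N (λ z s → g z (false ∷ s)) (λ z s → g≤N z (false ∷ s)) sat₁
    ...   | v₂ , sat₂ =
      (λ { (true ∷ s) → v₁ s ; (false ∷ s) → v₂ s }) ,
      satisfiableIn-⊆ (λ ((Cz , gz≡v₁) , gz≡v₂) → Cz , λ { (true ∷ s) → gz≡v₁ s ; (false ∷ s) → gz≡v₂ s })
                      sat₂

    infix 4 _≈ₐ[_]_
    _≈ₐ[_]_ : M → ℕ → M → Set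
    z ≈ₐ[ N ] x = (z ∷ₑ a) ≈[ N ] (x ∷ₑ a)

    Good : ℕ → M → Set
    Good N x = SatisfiableIn (_≈ₐ[ N ] x)

    profile : ℕ → M → Vec Bool (suc k) → ℕ
    profile N z s = truncSize N (Cell (z ∷ₑ a) s)

    good-step : ∀ {x} → Good N x → Σ M λ x′ → Good (suc N) x′ × x′ ≈ₐ[ N ] x
    good-step {N} good with satisfiableIn-constant (suc N) (profile (suc N)) (λ _ _ → truncSize-≤ _ _) good
    ... | v , sat with sat [] []
    ...   | x′ , (x′≈x , x′-profile) , _ =
      x′ ,
      satisfiableIn-⊆ (λ (_ , z-profile) s → truncSize≡⇒≃ (trans (z-profile s) (sym (x′-profile s)))) sat ,
      x′≈x

    chain : ∀ N → Σ M (Good N)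
    chain zero    = 𝟘 , λ φs pφs → let z , rz = p-finSat φs pφs in z , (λ _ → ≃-zero) , rz
    chain (suc N) = let x′ , good′ , _ = good-step (proj₂ (chain N)) in x′ , good′

    approx : ℕ → M
    approx = proj₁ ∘ chain

    approx-coherent : ∀ {N N′} → N ≤ N′ → approx N′ ≈ₐ[ N ] approx N
    approx-coherent = go ∘ ≤⇒≤′
      where
      go : ∀ {N N′} → N ≤′ N′ → approx N′ ≈ₐ[ N ] approx N
      go ≤′-refl                  = ≈-refl
      go (≤′-step {N′} N≤′N′) =
        ≈-trans (≈-≤ (≤′⇒≤ N≤′N′) (proj₂ (proj₂ (good-step (proj₂ (chain N′)))))) (go N≤′N′)

    open Limit split avoid a approx approx-coherent using (limit; ≈-limit)

    realized : Realized _⊑_ a p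
    realized = limit , λ φ pφ →
      let z , z≈x , sat = proj₂ (chain (2 ^ depth φ)) (φ ∷ []) (pφ ∷ [])
      in ≈-Sat φ (≈-trans z≈x (≈-limit _)) (All.head sat)

  ω-saturated : InfiniteSplitting → InfiniteAvoidance → OmegaSaturated _⊑_
  ω-saturated split avoid k a p p-finSat = Saturation.realized split avoid a p p-finSat

  -- A strictly descending chain of length m below variable zero; it expresses "at least m atoms".
  atLeastAtoms : ℕ → Formula (suc n)
  atLeastAtoms zero    = ⊥' ⇒ ⊥'
  atLeastAtoms (suc m) = ∃' (((zero ⊑' suc zero) ∧' ((suc zero ⊑' zero) ⇒ ⊥')) ∧' atLeastAtoms m)

  sat-atLeastAtoms⇒ : ∀ m (ρ : Fin (suc n) → M) → Sat _⊑_ ρ (atLeastAtoms m) → AtLeast (Atoms (ρ zero)) m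
  sat-atLeastAtoms⇒ zero    ρ _ = atLeast-zero
  sat-atLeastAtoms⇒ (suc m) ρ (w , (w⊑ρ₀ , ρ₀⋢w) , sat) with sat-atLeastAtoms⇒ m (w ∷ₑ ρ) sat | ⋢⇒atom ρ₀⋢w
  ... | ws , uws , ws-atoms , m≤ | c , c∈ρ₀ , c⋢w =
    atLeast-≤ (s≤s m≤) (atLeast-∷ c∈ρ₀ (c⋢w ∘ proj₂ ∘ All.lookup ws-atoms) uws
                                  (All.map (λ (b-atom , b⊑w) → b-atom , ⊑-trans b⊑w w⊑ρ₀) ws-atoms))

  atoms⇒sat-atLeastAtoms : ∀ (ρ : Fin (suc n) → M) {ks} → Unique ks → All (Atoms (ρ zero)) ks →
                           Sat _⊑_ ρ (atLeastAtoms (length ks))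
  atoms⇒sat-atLeastAtoms ρ []                     _                   = λ ()
  atoms⇒sat-atLeastAtoms ρ {c ∷ ks} (c∉ks ∷ uks) ((c-atom , c⊑ρ₀) ∷ ks-atoms) =
    ⋃ ks ,
    (⋃⊑ (All.map proj₂ ks-atoms) , λ ρ₀⊑⋃ks → All¬⇒¬Any c∉ks (c∈ks (⊑-trans c⊑ρ₀ ρ₀⊑⋃ks))) ,
    atoms⇒sat-atLeastAtoms (⋃ ks ∷ₑ ρ) uks (All.tabulate λ k∈ → proj₁ (All.lookup ks-atoms k∈) , ⊑⋃ k∈)
    where
    c∈ks : c ⊑ ⋃ ks → c ∈ ks
    c∈ks = to (atom-⋃-atoms (All.map proj₁ ks-atoms) c-atom)

  sat-atLeastAtoms : ∀ m (ρ : Fin (suc n) → M) → Sat _⊑_ ρ (atLeastAtoms m) ⇔ AtLeast (Atoms (ρ zero)) m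
  sat-atLeastAtoms m ρ = mk⇔ (sat-atLeastAtoms⇒ m ρ) λ ρ₀≥m →
    let ks , uks , ks-atoms , len≡m = exactly ρ₀≥m
    in subst (Sat _⊑_ ρ ∘ atLeastAtoms) len≡m (atoms⇒sat-atLeastAtoms ρ uks ks-atoms)

  disjointᶠ : Fin n → Fin n → Formula n
  disjointᶠ i j = ∀' ((zero ⊑' suc i) ⇒ ((zero ⊑' suc j) ⇒ ∀' (suc zero ⊑' zero)))

  sat-disjoint : ∀ (ρ : Fin n → M) i j → Sat _⊑_ ρ (disjointᶠ i j) ⇔ Disjoint (ρ i) (ρ j)
  sat-disjoint ρ i j = mk⇔
    (λ sat → ⊑𝟘⇒≡𝟘 (sat _ (∩-lowerˡ (ρ i) (ρ j)) (∩-lowerʳ (ρ i) (ρ j)) 𝟘))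
    (λ ρi∩ρj≡𝟘 z z⊑ρi z⊑ρj w → ⊑-trans (subst (z ⊑_) ρi∩ρj≡𝟘 (∩-greatest z⊑ρi z⊑ρj)) (𝟘-least w))

  realize-family : OmegaSaturated _⊑_ → ∀ {k} (a : Fin k → M) (F : ℕ → Formula (suc k)) →
                   (∀ B → Σ M λ x → ∀ m → m ≤ B → Sat _⊑_ (x ∷ₑ a) (F m)) →
                   Σ M λ x → ∀ m → Sat _⊑_ (x ∷ₑ a) (F m)
  realize-family saturated {k} a F bounded =
    let x , sat = saturated k a typeOf finSat in x , λ m → sat (F m) (m , refl)
    where
    typeOf : OneType k
    typeOf φ = Σ ℕ λ m → φ ≡ F m

    bound : ∀ {φs} → All typeOf φs → ℕ
    bound []             = 0
    bound ((m , _) ∷ ps) = m ⊔ bound ps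

    sat-below : ∀ {x B φs} → (∀ m → m ≤ B → Sat _⊑_ (x ∷ₑ a) (F m)) → (ps : All typeOf φs) → bound ps ≤ B →
                All (Sat _⊑_ (x ∷ₑ a)) φs
    sat-below sat []                  _ = []
    sat-below sat ((m , refl) ∷ ps) ≤B = sat m (m⊔n≤o⇒m≤o m _ ≤B) ∷ sat-below sat ps (m⊔n≤o⇒n≤o m _ ≤B)

    finSat : FinitelySatisfiable _⊑_ a typeOf
    finSat φs ps = let x , sat = bounded (bound ps) in x , sat-below sat ps ≤-refl

  ⋃-atLeast : Unique xs → All IsAtom xs → AtLeast (Atoms (⋃ xs)) (length xs)
  ⋃-atLeast uxs xs-atoms = _ , uxs , All.tabulate (λ x∈ → All.lookup xs-atoms x∈ , ⊑⋃ x∈) , ≤-refl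

  ⊑⇒∩≡ : y ⊑ x → x ∩ y ≡ y
  ⊑⇒∩≡ y⊑x = ⊑-antisym (∩-lowerʳ _ _) (∩-greatest y⊑x (⊑-refl _))

  ⊑⇒≡∪− : y ⊑ x → x ≡ y ∪ (x − y)
  ⊑⇒≡∪− {y} {x} y⊑x = trans (sym (−-covers x y)) (cong (_∪ (x − y)) (⊑⇒∩≡ y⊑x))

  ⊑⇒disjoint− : y ⊑ x → Disjoint y (x − y)
  ⊑⇒disjoint− {y} {x} y⊑x = subst (λ z → Disjoint z (x − y)) (⊑⇒∩≡ y⊑x) (−-disjoint x y)

  infinite-⊑ : x ⊑ y → Infinite x → Infinite y
  infinite-⊑ x⊑y x-inf = atLeast⇒infinite λ m →
    atLeast-⊆ (λ (c-atom , c⊑x) → c-atom , ⊑-trans c⊑x x⊑y) (infinite⇒atLeast x-inf m)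

  saturated⇒avoidance : OmegaSaturated _⊑_ → InfiniteAvoidance
  saturated⇒avoidance saturated a₀ =
    let x , sat = realize-family saturated ρ₀ F bounded
    in x , atLeast⇒infinite (λ m → to (sat-atLeastAtoms m (x ∷ₑ ρ₀)) (proj₂ (sat m))) ,
       to (sat-disjoint (x ∷ₑ ρ₀) zero (suc zero)) (proj₁ (sat 0))
    where
    ρ₀ : Fin 1 → M
    ρ₀ _ = a₀

    F : ℕ → Formula 2
    F m = disjointᶠ zero (suc zero) ∧' atLeastAtoms m

    bounded : ∀ B → Σ M λ x → ∀ m → m ≤ B → Sat _⊑_ (x ∷ₑ ρ₀) (F m)
    bounded B with exactly (atoms-outside a₀ B)
    ... | ks , uks , ks-out , len≡B = ⋃ ks , λ m m≤B →
      from (sat-disjoint (⋃ ks ∷ₑ ρ₀) zero (suc zero)) (atoms-𝟘 λ c-atom c⊑ →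
        proj₂ (All.lookup ks-out (to (atom-⋃-atoms ks-atoms c-atom) (⊑∩⇒ˡ c⊑))) (⊑∩⇒ʳ c⊑)) ,
      from (sat-atLeastAtoms m (⋃ ks ∷ₑ ρ₀)) (atLeast-≤ (subst (m ≤_) (sym len≡B) m≤B) (⋃-atLeast uks ks-atoms))
      where
      ks-atoms = All.map proj₁ ks-out

  saturated⇒splitting : OmegaSaturated _⊑_ → InfiniteSplitting
  saturated⇒splitting saturated u₀ u₀-inf =
    let x , sat = realize-family saturated ρ₀ F bounded
        x⊑u₀ , x≥ , _ = sat 0
        rest≥ : ∀ m → AtLeast (Atoms (u₀ − x)) m
        rest≥ m = let d , (d⊑u₀ , d∩x≡𝟘) , d≥m = proj₂ (proj₂ (sat m)) in
          atLeast-⊆ (λ (c-atom , c⊑d) → c-atom , from (atom-− c-atom)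
                       (⊑-trans c⊑d d⊑u₀ ,
                        atom-disjoint (to (sat-disjoint (d ∷ₑ (x ∷ₑ ρ₀)) zero (suc zero)) d∩x≡𝟘) c-atom c⊑d))
                    (to (sat-atLeastAtoms m (d ∷ₑ (x ∷ₑ ρ₀))) d≥m)
    in x , u₀ − x ,
       atLeast⇒infinite (λ m → to (sat-atLeastAtoms m (x ∷ₑ ρ₀)) (proj₁ (proj₂ (sat m)))) ,
       atLeast⇒infinite rest≥ , ⊑⇒disjoint− x⊑u₀ , ⊑⇒≡∪− x⊑u₀
    where
    ρ₀ : Fin 1 → M
    ρ₀ _ = u₀

    -- x ⊑ u₀, x has m atoms, and so has some d ⊑ u₀ disjoint from x.
    F : ℕ → Formula 2
    F m = (zero ⊑' suc zero) ∧' (atLeastAtoms m ∧'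
            ∃' (((zero ⊑' suc (suc zero)) ∧' disjointᶠ zero (suc zero)) ∧' atLeastAtoms m))

    bounded : ∀ B → Σ M λ x → ∀ m → m ≤ B → Sat _⊑_ (x ∷ₑ ρ₀) (F m)
    bounded B with exactly (atLeast-≤ (m≤m+n B B) (infinite⇒atLeast u₀-inf (B + B)))
    ... | ks , uks , ks⊆u₀ , len≡B = ⋃ ks , λ m m≤B →
      ⋃⊑ (All.map proj₂ ks⊆u₀) ,
      from (sat-atLeastAtoms m (⋃ ks ∷ₑ ρ₀)) (atLeast-≤ (subst (m ≤_) (sym len≡B) m≤B) (⋃-atLeast uks ks-atoms)) ,
      u₀ − ⋃ ks ,
      (−-⊑ u₀ (⋃ ks) , from (sat-disjoint ((u₀ − ⋃ ks) ∷ₑ (⋃ ks ∷ₑ ρ₀)) zero (suc zero))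
                          (atoms-𝟘 λ c-atom c⊑ → proj₂ (to (atom-− c-atom) (⊑∩⇒ˡ c⊑)) (⊑∩⇒ʳ c⊑))) ,
      from (sat-atLeastAtoms m ((u₀ − ⋃ ks) ∷ₑ (⋃ ks ∷ₑ ρ₀))) (atLeast-≤ m≤B rest≥B)
      where
      ks-atoms = All.map proj₁ ks⊆u₀

      rest≥B : AtLeast (Atoms (u₀ − ⋃ ks)) B
      rest≥B = atLeast-⊆ (λ ((c-atom , c⊑u₀) , c∉ks) → c-atom , from (atom-− c-atom)
                             (c⊑u₀ , c∉ks ∘ to (atom-⋃-atoms ks-atoms c-atom)))
                         (atLeast-∖⁻ (subst (AtLeast (Atoms u₀) ∘ (B +_)) (sym len≡B) (infinite⇒atLeast u₀-inf (B + B))))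

  InfiniteTrisection : Set
  InfiniteTrisection = ∀ u → Infinite u → Σ M λ x →
    Σ M (λ d → IsDiff u x d × Infinite d) × Infinite (u ∩ x) × Σ M (λ e → IsDiff x u e × Infinite e)

  isDiff⇔ : IsDiff u x y ⇔ (∀ {c} → IsAtom c → c ⊑ y ⇔ (c ⊑ u × ¬ c ⊑ x))
  isDiff⇔ {u} {x} {y} = mk⇔
    (λ (y∩u∩x≡𝟘 , y∪u∩x≡u) {c} c-atom → mk⇔
      (λ c⊑y → subst (_ ⊑_) y∪u∩x≡u (⊑⇒∪ˡ c⊑y) ,
               λ c⊑x → atom-disjoint y∩u∩x≡𝟘 c-atom c⊑y
                         (∩-greatest (subst (_ ⊑_) y∪u∩x≡u (⊑⇒∪ˡ c⊑y)) c⊑x))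
      (λ (c⊑u , c⋢x) → [ (λ c⊑y → c⊑y) , (λ c⊑u∩x → contradiction (⊑∩⇒ʳ c⊑u∩x) c⋢x) ]′
                           (atom-∪ c-atom (subst (_ ⊑_) (sym y∪u∩x≡u) c⊑u))))
    (λ atoms⇔ →
      atoms-𝟘 (λ c-atom c⊑ → proj₂ (to (atoms⇔ c-atom) (⊑∩⇒ˡ c⊑)) (⊑∩⇒ʳ (⊑∩⇒ʳ c⊑))) ,
      atoms-≡ λ c-atom → mk⇔
        (λ c⊑ → [ proj₁ ∘ to (atoms⇔ c-atom) , ⊑∩⇒ˡ ]′ (atom-∪ c-atom c⊑))
        (λ c⊑u → dne λ c⋢ → c⋢ (⊑⇒∪ˡ (from (atoms⇔ c-atom)
                                         (c⊑u , λ c⊑x → c⋢ (⊑⇒∪ʳ (∩-greatest c⊑u c⊑x)))))))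

  splitting+avoidance⇒trisection : InfiniteSplitting → InfiniteAvoidance → InfiniteTrisection
  splitting+avoidance⇒trisection split avoid u u-inf with split u u-inf | avoid u
  ... | v , w , v-inf , w-inf , v∩w≡𝟘 , u≡v∪w | u′ , u′-inf , u′∩u≡𝟘 =
    v ∪ u′ ,
    (w , from isDiff⇔ (λ c-atom → mk⇔
           (λ c⊑w → ⊑u (⊑⇒∪ʳ c⊑w) ,
                    [ (λ c⊑v → atom-disjoint v∩w≡𝟘 c-atom c⊑v c⊑w) ,
                      (λ c⊑u′ → atom-disjoint u′∩u≡𝟘 c-atom c⊑u′ (⊑u (⊑⇒∪ʳ c⊑w))) ]′ ∘ atom-∪ c-atom)
           (λ (c⊑u , c⋢v∪u′) → [ (λ c⊑v → contradiction (⊑⇒∪ˡ c⊑v) c⋢v∪u′) , (λ c⊑w → c⊑w) ]′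
                                   (atom-∪ c-atom (subst (_ ⊑_) u≡v∪w c⊑u)))) ,
     w-inf) ,
    infinite-⊑ (∩-greatest (⊑u (∪-upperˡ v w)) (∪-upperˡ v u′)) v-inf ,
    (u′ , from isDiff⇔ (λ c-atom → mk⇔
            (λ c⊑u′ → ⊑⇒∪ʳ c⊑u′ , atom-disjoint u′∩u≡𝟘 c-atom c⊑u′)
            (λ (c⊑v∪u′ , c⋢u) → [ (λ c⊑v → contradiction (⊑u (⊑⇒∪ˡ c⊑v)) c⋢u) , (λ c⊑u′ → c⊑u′) ]′
                                    (atom-∪ c-atom c⊑v∪u′))) ,
     u′-inf)
    where
    ⊑u : ∀ {c} → c ⊑ (v ∪ w) → c ⊑ u
    ⊑u = subst (_ ⊑_) (sym u≡v∪w)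

  trisection⇒splitting : InfiniteTrisection → InfiniteSplitting
  trisection⇒splitting trisect u u-inf =
    let x , (d , (d∩u∩x≡𝟘 , d∪u∩x≡u) , d-inf) , u∩x-inf , _ = trisect u u-inf
    in d , u ∩ x , d-inf , u∩x-inf , d∩u∩x≡𝟘 , sym d∪u∩x≡u

  trisection⇒avoidance : Σ M Infinite → InfiniteTrisection → InfiniteAvoidance
  trisection⇒avoidance (u₀ , u₀-inf) trisect a =
    let _ , _ , _ , e , e-diff , e-inf = trisect (u₀ ∪ a) (infinite-⊑ (∪-upperˡ u₀ a) u₀-inf)
    in e , e-inf , atoms-𝟘 λ c-atom c⊑e∩a →
         proj₂ (to (to isDiff⇔ e-diff c-atom) (⊑∩⇒ˡ c⊑e∩a)) (⊑⇒∪ʳ (⊑∩⇒ʳ c⊑e∩a))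

  avoidance⇒infinite : InfiniteAvoidance → Σ M Infinite
  avoidance⇒infinite avoid = let u , u-inf , _ = avoid 𝟘 in u , u-inf

theorem4 : ExcludedMiddle 0ℓ →
    {M : Set} (_⊑_ : M → M → Set) (isM : IsMereology _⊑_) →
    let open Mereology _⊑_ isM in
    (OmegaSaturated _⊑_ ⇔
      ((∀ u → Infinite u → Σ M (λ v → Σ M (λ w →
            Infinite v × Infinite w × Disjoint v w × (u ≡ (v ∪ w)))))
       × (∀ a → Σ M (λ u → Infinite u × Disjoint u a))))
    × (OmegaSaturated _⊑_ ⇔
      (Σ M Infinite
       × (∀ u → Infinite u → Σ M (λ x →
            Σ M (λ d → IsDiff u x d × Infinite d)
            × Infinite (u ∩ x)
            × Σ M (λ e → IsDiff x u e × Infinite e)))))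
theorem4 lem _⊑_ isM =
  mk⇔ (λ saturated → saturated⇒splitting saturated , saturated⇒avoidance saturated)
      (λ (split , avoid) → ω-saturated split avoid) ,
  mk⇔ (λ saturated → let avoid = saturated⇒avoidance saturated
                     in avoidance⇒infinite avoid , splitting+avoidance⇒trisection (saturated⇒splitting saturated) avoid)
      (λ (u-inf , trisect) → ω-saturated (trisection⇒splitting trisect) (trisection⇒avoidance u-inf trisect))
  where open Model lem _⊑_ isM
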